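{- Let $G$ be a finite transitive permutation group on a set $V$ with point stabilizers of order $3$, and suppose $\mathcal{F}$ is a maximal (with respect to inclusion) basic intersecting set of $G$ with $|\mathcal{F}|=4$. Then no point stabilizer $G_v$, $v\in V$, is contained in $\mathcal{F}$; that is, $\mathcal{F}=\{1,x,y,z\}$ with $x$, $y$, $z$ belonging to pairwise different point stabilizers.
   Context: A subset $\mathcal{F}\subseteq G$ is intersecting if for any $g,h\in\mathcal{F}$ there is $v\in V$ with $g(v)=h(v)$; it is basic if it contains the identity element $1$ of $G$. -}

module Defs where

open import Data.Nat using (ℕ)
open import Data.Fin using (Fin)
open import Data.Vec using (Vec; lookup; tabulate)
open import Data.List using (List; length)
open import Data.List.Membership.Propositional using (_∈_)
open import Data.List.Relation.Unary.All using (All)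
open import Data.List.Relation.Unary.Unique.Propositional using (Unique)
open import Data.Product using (Σ; ∃; _×_)
open import Function.Base using (id)
open import Function.Bundles using (_⇔_)
open import Function.Definitions using (Injective)
open import Relation.Binary.PropositionalEquality using (_≡_)

-- A map V → V with V = Fin n, stored as its table of values (so that
-- equality of maps is propositional equality, and decidable).
Arr : ℕ → Set
Arr n = Vec (Fin n) n

_·_ : ∀ {n} → Arr n → Fin n → Fin n
σ · v = lookup σ v

idP : ∀ {n} → Arr n
idP = tabulate id

_∘P_ : ∀ {n} → Arr n → Arr n → Arr n
σ ∘P τ = tabulate (λ v → σ · (τ · v))

-- A permutation group on V = Fin n (automatically finite), given as the
-- predicate "is an element of G".
record PermGroup (n : ℕ) : Set₁ where
  field
    Mem     : Arr n → Set
    -- elements are permutations (injective self-map of a finite set = bijection)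
    perm    : ∀ σ → Mem σ → Injective _≡_ _≡_ (σ ·_)
    id-mem  : Mem idP
    comp-mem : ∀ σ τ → Mem σ → Mem τ → Mem (σ ∘P τ)
    inv-mem : ∀ σ → Mem σ → Σ (Arr n) λ τ → Mem τ × (σ ∘P τ ≡ idP) × (τ ∘P σ ≡ idP)

open PermGroup public

HasSize : ∀ {A : Set} → (A → Set) → ℕ → Set
HasSize {A} P k = Σ (List A) λ xs → Unique xs × (length xs ≡ k) × (∀ a → P a ⇔ (a ∈ xs))

IsTransitive : ∀ {n} → PermGroup n → Set
IsTransitive {n} G = ∀ (u v : Fin n) → Σ (Arr n) λ σ → Mem G σ × (σ · u ≡ v)

InStab : ∀ {n} → PermGroup n → Fin n → Arr n → Set
InStab G v σ = Mem G σ × (σ · v ≡ v)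

StabilizersOfOrder : ∀ {n} → PermGroup n → ℕ → Set
StabilizersOfOrder {n} G k = ∀ (v : Fin n) → HasSize (InStab G v) k

-- subsets of G are represented by lists of elements of G
-- (G is finite, so every subset is so representable)
IsSubsetOf : ∀ {n} → PermGroup n → List (Arr n) → Set
IsSubsetOf G F = All (Mem G) F

IsIntersecting : ∀ {n} → List (Arr n) → Set
IsIntersecting {n} F = ∀ g h → g ∈ F → h ∈ F → ∃ λ (v : Fin n) → g · v ≡ h · v

IsBasic : ∀ {n} → List (Arr n) → Set
IsBasic F = idP ∈ F

IsBasicIntersecting : ∀ {n} → PermGroup n → List (Arr n) → Set
IsBasicIntersecting G F = IsSubsetOf G F × IsBasic F × IsIntersecting F

_⊆L_ : ∀ {n} → List (Arr n) → List (Arr n) → Set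
F ⊆L F′ = ∀ x → x ∈ F → x ∈ F′

IsMaximalBasicIntersecting : ∀ {n} → PermGroup n → List (Arr n) → Set
IsMaximalBasicIntersecting {n} G F =
  IsBasicIntersecting G F ×
  (∀ (F′ : List (Arr n)) → IsBasicIntersecting G F′ → F ⊆L F′ → F′ ⊆L F)

-- Suppose G_v ⊆ F. As |G_v| = 3 and |F| = 4, F = G_v ∪ {y} for a single y
-- moving v. For 1 ≠ x ∈ G_v the element y x still meets every member of F:
-- it agrees with y at v, and for h ∈ G_v the elements y and h x⁻¹ ∈ F agree
-- at some w, so y x and h agree at x⁻¹ w. By maximality y x ∈ F; it moves v,
-- so y x = y and x = 1, a contradiction. If two distinct nonidentity x, y ∈ F
-- lay in one G_v, then G_v = {1, x, y} ⊆ F, which was just excluded.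
module Submission where

open import Defs
open import Data.Nat using (ℕ; suc; _≤_; _<_)
open import Data.Nat.Properties using (_≤?_; ≰⇒>; <⇒≱; ≤-reflexive)
open import Data.Fin using (Fin) renaming (_≟_ to _≟ᶠ_)
open import Data.Fin.Properties using (pigeonhole; <-irrefl)
open import Data.Vec.Properties using (lookup∘tabulate; tabulate∘lookup; tabulate-cong; ≡-dec)
open import Data.List using (List; []; _∷_; length; lookup)
open import Data.List.Membership.Propositional using (_∈_; _∉_; find)
open import Data.List.Membership.Propositional.Properties using (∈-lookup)
open import Data.List.Relation.Binary.Subset.Propositional using (_⊆_)
import Data.List.Relation.Unary.All as All
open import Data.List.Relation.Unary.All.Properties using (¬All⇒Any¬; ¬Any⇒All¬)
open import Data.List.Relation.Unary.Any using (here; there; index)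
open import Data.List.Relation.Unary.Any.Properties using (lookup-index)
open import Data.List.Relation.Unary.AllPairs using ([]; _∷_)
open import Data.List.Relation.Unary.Unique.Propositional using (Unique)
open import Data.Product using (_×_; _,_; proj₁; proj₂; ∃)
open import Function.Base using (_∘_)
open import Function.Bundles using (Equivalence)
open import Relation.Binary.Definitions using (DecidableEquality)
open import Relation.Binary.PropositionalEquality
open import Relation.Nullary using (¬_; yes; no)
open import Relation.Nullary.Negation using (contradiction)

open Equivalence using (to; from)

module _ {A : Set} where

  Unique⇒lookup-injective : ∀ {xs : List A} → Unique xs →
                            ∀ i j → lookup xs i ≡ lookup xs j → i ≡ j
  Unique⇒lookup-injective (_ ∷ _) Fin.zero Fin.zero _ = refl
  Unique⇒lookup-injective (x∉xs ∷ _) Fin.zero (Fin.suc j) eq =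
    contradiction eq (All.lookup x∉xs (∈-lookup j))
  Unique⇒lookup-injective (x∉xs ∷ _) (Fin.suc i) Fin.zero eq =
    contradiction (sym eq) (All.lookup x∉xs (∈-lookup i))
  Unique⇒lookup-injective (_ ∷ xs!) (Fin.suc i) (Fin.suc j) eq =
    cong Fin.suc (Unique⇒lookup-injective xs! i j eq)

  Unique-length-≤ : ∀ {xs ys : List A} → Unique xs → xs ⊆ ys → length xs ≤ length ys
  Unique-length-≤ {xs} {ys} xs! xs⊆ys with length xs ≤? length ys
  ... | yes |xs|≤|ys| = |xs|≤|ys|
  ... | no |xs|≰|ys|
    with i , j , i<j , eq ← pigeonhole (≰⇒> |xs|≰|ys|) (index ∘ xs⊆ys ∘ ∈-lookup)
    = contradiction i<j (<-irrefl (Unique⇒lookup-injective xs! i j lookup-i≡lookup-j))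
    where
    lookup-i≡lookup-j : lookup xs i ≡ lookup xs j
    lookup-i≡lookup-j = trans (lookup-index (xs⊆ys (∈-lookup i)))
      (trans (cong (lookup ys) eq) (sym (lookup-index (xs⊆ys (∈-lookup j)))))

  Unique-∷ : ∀ {x : A} {xs} → x ∉ xs → Unique xs → Unique (x ∷ xs)
  Unique-∷ x∉xs xs! = ¬Any⇒All¬ _ x∉xs ∷ xs!

  module _ (_≟_ : DecidableEquality A) where
    open import Data.List.Membership.DecPropositional _≟_ using (_∈?_)

    Unique-longer⇒∃∉ : ∀ {xs ys : List A} → Unique ys → length xs < length ys →
                       ∃ λ y → y ∈ ys × y ∉ xs
    Unique-longer⇒∃∉ {xs} {ys} ys! |xs|<|ys| = find (¬All⇒Any¬ (_∈? xs) ys ys⊈xs)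
      where
      ys⊈xs : ¬ All.All (_∈ xs) ys
      ys⊈xs ys⊆xs = <⇒≱ |xs|<|ys| (Unique-length-≤ ys! (All.lookup ys⊆xs))

    Unique-⊆-length-≥⇒⊇ : ∀ {xs ys : List A} → Unique xs → xs ⊆ ys →
                          length ys ≤ length xs → ys ⊆ xs
    Unique-⊆-length-≥⇒⊇ {xs} {ys} xs! xs⊆ys |ys|≤|xs| {a} a∈ys with a ∈? xs
    ... | yes a∈xs = a∈xs
    ... | no a∉xs = contradiction |ys|≤|xs| (<⇒≱ (Unique-length-≤ (Unique-∷ a∉xs xs!) a∷xs⊆ys))
      where
      a∷xs⊆ys : a ∷ xs ⊆ ys
      a∷xs⊆ys (here refl) = a∈ys
      a∷xs⊆ys (there b∈xs) = xs⊆ys b∈xs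

    ∉-unique : ∀ {xs ys : List A} {a b} → Unique xs → xs ⊆ ys →
               length ys ≤ suc (length xs) →
               a ∈ ys → b ∈ ys → a ∉ xs → b ∉ xs → a ≡ b
    ∉-unique {xs} {ys} {a} {b} xs! xs⊆ys |ys|≤1+|xs| a∈ys b∈ys a∉xs b∉xs with a ≟ b
    ... | yes a≡b = a≡b
    ... | no a≢b = contradiction |ys|≤1+|xs| (<⇒≱ (Unique-length-≤ a∷b∷xs! a∷b∷xs⊆ys))
      where
      a∉b∷xs : a ∉ b ∷ xs
      a∉b∷xs (here a≡b) = a≢b a≡b
      a∉b∷xs (there a∈xs) = a∉xs a∈xs
      a∷b∷xs! : Unique (a ∷ b ∷ xs)
      a∷b∷xs! = Unique-∷ a∉b∷xs (Unique-∷ b∉xs xs!)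
      a∷b∷xs⊆ys : a ∷ b ∷ xs ⊆ ys
      a∷b∷xs⊆ys (here refl) = a∈ys
      a∷b∷xs⊆ys (there (here refl)) = b∈ys
      a∷b∷xs⊆ys (there (there c∈xs)) = xs⊆ys c∈xs

    HasSize-∃-≢ : ∀ {P : A → Set} {k} → HasSize P (suc (suc k)) → ∀ a → ∃ λ x → P x × x ≢ a
    HasSize-∃-≢ ([] , _ , () , _)
    HasSize-∃-≢ (_ ∷ [] , _ , () , _)
    HasSize-∃-≢ (p ∷ q ∷ _ , (p≢q All.∷ _) ∷ _ , _ , P⇔) a with p ≟ a
    ... | no p≢a = p , from (P⇔ p) (here refl) , p≢a
    ... | yes refl = q , from (P⇔ q) (there (here refl)) , p≢q ∘ sym

    HasSize-exhausted : ∀ {P : A → Set} {k xs} → HasSize P k → Unique xs →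
                        (∀ a → a ∈ xs → P a) → k ≤ length xs → ∀ a → P a → a ∈ xs
    HasSize-exhausted (ps , _ , |ps|≡k , P⇔) xs! xs⊆P k≤|xs| a Pa =
      Unique-⊆-length-≥⇒⊇ xs! (λ {b} b∈xs → to (P⇔ b) (xs⊆P b b∈xs))
        (subst (_≤ _) (sym |ps|≡k) k≤|xs|) (to (P⇔ a) Pa)

module _ {n : ℕ} where

  _≟ᴬ_ : DecidableEquality (Arr n)
  _≟ᴬ_ = ≡-dec _≟ᶠ_

  ·-∘P : ∀ (σ τ : Arr n) u → (σ ∘P τ) · u ≡ σ · (τ · u)
  ·-∘P σ τ u = lookup∘tabulate _ u

  idP-· : ∀ u → idP {n} · u ≡ u
  idP-· u = lookup∘tabulate _ u

  ·-ext : ∀ {σ τ : Arr n} → (∀ u → σ · u ≡ τ · u) → σ ≡ τ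
  ·-ext {σ} {τ} σ≗τ = trans (sym (tabulate∘lookup σ)) (trans (tabulate-cong σ≗τ) (tabulate∘lookup τ))

  ∘P-rightInverse-· : ∀ (σ ρ : Arr n) → σ ∘P ρ ≡ idP → ∀ u → σ · (ρ · u) ≡ u
  ∘P-rightInverse-· σ ρ σρ≡id u = begin
    σ · (ρ · u)    ≡⟨ ·-∘P σ ρ u ⟨
    (σ ∘P ρ) · u   ≡⟨ cong (_· u) σρ≡id ⟩
    idP · u        ≡⟨ idP-· u ⟩
    u              ∎
    where open ≡-Reasoning

  ∘P-fix-· : ∀ (σ τ : Arr n) {v} → τ · v ≡ v → (σ ∘P τ) · v ≡ σ · v
  ∘P-fix-· σ τ {v} τv≡v = trans (·-∘P σ τ v) (cong (σ ·_) τv≡v)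

  Meet : Arr n → Arr n → Set
  Meet σ τ = ∃ λ u → σ · u ≡ τ · u

  Meet-sym : ∀ {σ τ : Arr n} → Meet σ τ → Meet τ σ
  Meet-sym (u , eq) = u , sym eq

  Meet-∘P : ∀ {x ρ y h : Arr n} → x ∘P ρ ≡ idP → Meet y (h ∘P ρ) → Meet (y ∘P x) h
  Meet-∘P {x} {ρ} {y} {h} xρ≡id (w , yw≡hρw) = ρ · w , (begin
    (y ∘P x) · (ρ · w)   ≡⟨ ·-∘P y x (ρ · w) ⟩
    y · (x · (ρ · w))    ≡⟨ cong (y ·_) (∘P-rightInverse-· x ρ xρ≡id w) ⟩
    y · w                ≡⟨ yw≡hρw ⟩
    (h ∘P ρ) · w         ≡⟨ ·-∘P h ρ w ⟩
    h · (ρ · w)          ∎)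
    where open ≡-Reasoning

  ∷-intersecting : ∀ {g F} → Fin n → (∀ h → h ∈ F → Meet g h) →
                   IsIntersecting F → IsIntersecting (g ∷ F)
  ∷-intersecting v _ _ _ _ (here refl) (here refl) = v , refl
  ∷-intersecting v g-meets _ _ h (here refl) (there h∈F) = g-meets h h∈F
  ∷-intersecting {g} v g-meets _ h _ (there h∈F) (here refl) = Meet-sym {g} {h} (g-meets h h∈F)
  ∷-intersecting v _ F-int h h′ (there h∈F) (there h′∈F) = F-int h h′ h∈F h′∈F

module _ {n : ℕ} (G : PermGroup n) where

  ∘P-≡ˡ⇒idP : ∀ {σ τ} → Mem G σ → σ ∘P τ ≡ σ → τ ≡ idP
  ∘P-≡ˡ⇒idP {σ} {τ} σ∈G στ≡σ = ·-ext λ u → trans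
    (perm G σ σ∈G (trans (sym (·-∘P σ τ u)) (cong (_· u) στ≡σ)))
    (sym (idP-· u))

  InStab-∘P : ∀ {v σ τ} → InStab G v σ → InStab G v τ → InStab G v (σ ∘P τ)
  InStab-∘P {σ = σ} {τ} (σ∈G , σv≡v) (τ∈G , τv≡v) =
    comp-mem G _ _ σ∈G τ∈G , trans (∘P-fix-· σ τ τv≡v) σv≡v

  InStab-inverse : ∀ {v x} → InStab G v x → ∃ λ ρ → InStab G v ρ × x ∘P ρ ≡ idP
  InStab-inverse {v} {x} (x∈G , xv≡v) with inv-mem G x x∈G
  ... | ρ , ρ∈G , xρ≡id , _ =
    ρ , (ρ∈G , perm G x x∈G (trans (∘P-rightInverse-· x ρ xρ≡id v) (sym xv≡v))) , xρ≡id

  maximal-absorbs : ∀ {F g} → IsMaximalBasicIntersecting G F → Fin n → Mem G g →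
                    (∀ h → h ∈ F → Meet g h) → g ∈ F
  maximal-absorbs {F} {g} ((F⊆G , idP∈F , F-int) , F-max) v g∈G g-meets =
    F-max (g ∷ F) (g∈G All.∷ F⊆G , there idP∈F , ∷-intersecting v g-meets F-int)
      (λ _ → there) g (here refl)

module _ {n : ℕ} (G : PermGroup n) (stab : StabilizersOfOrder G 3)
         {F : List (Arr n)} (F! : Unique F) (|F|≡4 : length F ≡ 4)
         (F-maxBI : IsMaximalBasicIntersecting G F) where

  private
    F⊆G : ∀ {σ} → σ ∈ F → Mem G σ
    F⊆G = All.lookup (proj₁ (proj₁ F-maxBI))

    idP∈F : idP ∈ F
    idP∈F = proj₁ (proj₂ (proj₁ F-maxBI))

    F-int : IsIntersecting F
    F-int = proj₂ (proj₂ (proj₁ F-maxBI))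

  ∃-moving-∈F : ∀ v → ∃ λ y → y ∈ F × y · v ≢ v
  ∃-moving-∈F v with stab v
  ... | sl , _ , |sl|≡3 , sl⇔Gᵥ
    with y , y∈F , y∉sl ← Unique-longer⇒∃∉ _≟ᴬ_ F!
                            (≤-reflexive (trans (cong suc |sl|≡3) (sym |F|≡4)))
    = y , y∈F , λ yv≡v → y∉sl (to (sl⇔Gᵥ y) (F⊆G y∈F , yv≡v))

  moving-∈F-unique : ∀ {v h y} → (∀ σ → InStab G v σ → σ ∈ F) →
                     h ∈ F → y ∈ F → h · v ≢ v → y · v ≢ v → h ≡ y
  moving-∈F-unique {v} Gᵥ⊆F h∈F y∈F h-moves y-moves with stab v
  ... | sl , sl! , |sl|≡3 , sl⇔Gᵥ =
    ∉-unique _≟ᴬ_ sl! (λ {σ} σ∈sl → Gᵥ⊆F σ (from (sl⇔Gᵥ σ) σ∈sl))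
      (≤-reflexive (trans |F|≡4 (cong suc (sym |sl|≡3))))
      h∈F y∈F (moving∉sl h-moves) (moving∉sl y-moves)
    where
    moving∉sl : ∀ {σ} → σ · v ≢ v → σ ∉ sl
    moving∉sl σ-moves σ∈sl = σ-moves (proj₂ (from (sl⇔Gᵥ _) σ∈sl))

  translate-∈F : ∀ {v y x} → (∀ σ → InStab G v σ → σ ∈ F) →
                 y ∈ F → y · v ≢ v → InStab G v x → y ∘P x ∈ F
  translate-∈F {v} {y} {x} Gᵥ⊆F y∈F y-moves x∈Gᵥ with InStab-inverse G x∈Gᵥ
  ... | ρ , ρ∈Gᵥ , xρ≡id =
    maximal-absorbs G F-maxBI v (comp-mem G y x (F⊆G y∈F) (proj₁ x∈Gᵥ)) yx-meets
    where
    yx-meets : ∀ h → h ∈ F → Meet (y ∘P x) h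
    yx-meets h h∈F with h · v ≟ᶠ v
    ... | yes hv≡v =
      Meet-∘P {x = x} {ρ} {y} {h} xρ≡id (F-int y _ y∈F (Gᵥ⊆F _ (InStab-∘P G (F⊆G h∈F , hv≡v) ρ∈Gᵥ)))
    ... | no h-moves =
      subst (Meet (y ∘P x)) (sym (moving-∈F-unique Gᵥ⊆F h∈F y∈F h-moves y-moves))
        (v , ∘P-fix-· y x (proj₂ x∈Gᵥ))

  stabilizer-⊈ : ∀ v → ¬ (∀ σ → InStab G v σ → σ ∈ F)
  stabilizer-⊈ v Gᵥ⊆F
    with y , y∈F , y-moves ← ∃-moving-∈F v
       | x , x∈Gᵥ , x≢idP ← HasSize-∃-≢ _≟ᴬ_ (stab v) idP
    = x≢idP (∘P-≡ˡ⇒idP G (F⊆G y∈F) yx≡y)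
    where
    yx≡y : y ∘P x ≡ y
    yx≡y = moving-∈F-unique Gᵥ⊆F (translate-∈F Gᵥ⊆F y∈F y-moves x∈Gᵥ) y∈F
             (y-moves ∘ trans (sym (∘P-fix-· y x (proj₂ x∈Gᵥ)))) y-moves

  stabilizer-∩-nonidentity-unique :
    ∀ v x y → x ∈ F → y ∈ F → x ≢ idP → y ≢ idP → InStab G v x → InStab G v y → x ≡ y
  stabilizer-∩-nonidentity-unique v x y x∈F y∈F x≢idP y≢idP x∈Gᵥ y∈Gᵥ with x ≟ᴬ y
  ... | yes x≡y = x≡y
  ... | no x≢y = contradiction (λ σ σ∈Gᵥ → 1xy⊆F (Gᵥ⊆1xy σ σ∈Gᵥ)) (stabilizer-⊈ v)
    where
    1xy! : Unique (idP ∷ x ∷ y ∷ [])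
    1xy! = ((x≢idP ∘ sym) All.∷ (y≢idP ∘ sym) All.∷ All.[]) ∷ (x≢y All.∷ All.[]) ∷ All.[] ∷ []
    1xy⊆Gᵥ : ∀ σ → σ ∈ idP ∷ x ∷ y ∷ [] → InStab G v σ
    1xy⊆Gᵥ _ (here refl) = id-mem G , idP-· v
    1xy⊆Gᵥ _ (there (here refl)) = x∈Gᵥ
    1xy⊆Gᵥ _ (there (there (here refl))) = y∈Gᵥ
    Gᵥ⊆1xy : ∀ σ → InStab G v σ → σ ∈ idP ∷ x ∷ y ∷ []
    Gᵥ⊆1xy = HasSize-exhausted _≟ᴬ_ (stab v) 1xy! 1xy⊆Gᵥ (≤-reflexive refl)
    1xy⊆F : idP ∷ x ∷ y ∷ [] ⊆ F
    1xy⊆F (here refl) = idP∈F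
    1xy⊆F (there (here refl)) = x∈F
    1xy⊆F (there (there (here refl))) = y∈F

corollary5p3 : ∀ (n : ℕ) (G : PermGroup n) → IsTransitive G → StabilizersOfOrder G 3 →
    ∀ (F : List (Arr n)) → Unique F → length F ≡ 4 → IsMaximalBasicIntersecting G F →
    (∀ (v : Fin n) → ¬ (∀ σ → InStab G v σ → σ ∈ F)) ×
    (∀ (v : Fin n) (x y : Arr n) → x ∈ F → y ∈ F → ¬ (x ≡ idP) → ¬ (y ≡ idP) →
       InStab G v x → InStab G v y → x ≡ y)
corollary5p3 n G _ stab F F! |F|≡4 F-maxBI =
  stabilizer-⊈ G stab F! |F|≡4 F-maxBI ,
  stabilizer-∩-nonidentity-unique G stab F! |F|≡4 F-maxBI
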